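{- Let $n\ge 4$. Then $-4$ is an eigenvalue of the $n$-Queens' graph $\mathcal{Q}(n)$ with multiplicity $(n-3)^2$, and the family $\mathcal{F}_n=\{X_n^{(a,b)}\mid (a,b)\in[n-3]^2\}$ is a basis of the eigenspace $\mathcal{E}_{\mathcal{Q}(n)}(-4)$.
   Context: $[n]=\{1,\dots,n\}$. The $n$-Queens' graph $\mathcal{Q}(n)$ has vertex set $[n]^2$, and two distinct vertices $(i,j),(i',j')$ are adjacent if and only if $i=i'$, or $j=j'$, or $i+j=i'+j'$, or $i-j=i'-j'$. Vectors in $\mathbb{R}^{n^2}$ are indexed by $(i,j)\in[n]^2$. Let $X_4\in\mathbb{R}^{16}$ be the vector indexed by $[4]^2$ with $[X_4]_{(i,j)}=1$ for $(i,j)\in\{(1,2),(2,4),(3,1),(4,3)\}$, $[X_4]_{(i,j)}=-1$ for $(i,j)\in\{(1,3),(2,1),(3,4),(4,2)\}$, and $0$ otherwise. For $(a,b)\in[n-3]^2$, with $A=\{a,a+1,a+2,a+3\}$ and $B=\{b,b+1,b+2,b+3\}$, define $X_n^{(a,b)}\in\mathbb{R}^{n^2}$ by $[X_n^{(a,b)}]_{(i,j)}=[X_4]_{(i-a+1,j-b+1)}$ if $(i,j)\in A\times B$ and $0$ otherwise.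
   Formalization: Vectors have rational entries instead of real ones, so the eigenspace $\mathcal{E}_{\mathcal{Q}(n)}(-4)$ lies in ℚ^(n²), and the scalars in linear independence and spanning are rational. -}

module Defs where

open import Data.Nat as ℕ using (ℕ; zero; suc; _∸_; _≤ᵇ_)
open import Data.Fin using (Fin; toℕ)
open import Data.Bool using (Bool; true; false; if_then_else_; _∧_)
open import Data.Product using (_×_; _,_; ∃; Σ)
open import Data.Sum using (_⊎_)
open import Data.Rational using (ℚ; 0ℚ; 1ℚ; _+_; _*_; -_)
open import Data.Integer using (+_; -[1+_])
open import Data.Rational using (_/_)
open import Relation.Binary.PropositionalEquality using (_≡_; _≢_)
open import Relation.Nullary using (¬_; Dec; yes; no; does)
open import Relation.Nullary.Decidable using (_×-dec_; _⊎-dec_; ¬?)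
import Data.Fin.Properties as FinP
import Data.Nat.Properties as NatP

-- Vertices of Q(n) are pairs (i , j) of Fin n (0-indexed version of [n]^2).
-- Vectors in Q^{n^2} are functions Fin n → Fin n → ℚ.
Vect : ℕ → Set
Vect n = Fin n → Fin n → ℚ

-- Adjacency in the n-Queens' graph: distinct vertices sharing a row, a column,
-- an anti-diagonal (i + j = i' + j') or a diagonal (i - j = i' - j',
-- written i + j' = i' + j to stay in ℕ).
Line : ∀ {n} → Fin n → Fin n → Fin n → Fin n → Set
Line i j i' j' =
  (i ≡ i') ⊎ (j ≡ j') ⊎ (toℕ i ℕ.+ toℕ j ≡ toℕ i' ℕ.+ toℕ j')
    ⊎ (toℕ i ℕ.+ toℕ j' ≡ toℕ i' ℕ.+ toℕ j)

Adjacent : ∀ {n} → Fin n → Fin n → Fin n → Fin n → Set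
Adjacent i j i' j' = ¬ ((i ≡ i') × (j ≡ j')) × Line i j i' j'

adjacent? : ∀ {n} (i j i' j' : Fin n) → Dec (Adjacent i j i' j')
adjacent? i j i' j' =
  ¬? (i FinP.≟ i' ×-dec j FinP.≟ j')
  ×-dec (i FinP.≟ i' ⊎-dec j FinP.≟ j'
         ⊎-dec (toℕ i ℕ.+ toℕ j NatP.≟ toℕ i' ℕ.+ toℕ j')
         ⊎-dec (toℕ i ℕ.+ toℕ j' NatP.≟ toℕ i' ℕ.+ toℕ j))

adjMat : ∀ {n} → Fin n → Fin n → Fin n → Fin n → ℚ
adjMat i j i' j' = if does (adjacent? i j i' j') then 1ℚ else 0ℚ

sumFin : ∀ n → (Fin n → ℚ) → ℚ
sumFin zero    f = 0ℚ
sumFin (suc n) f = f Fin.zero + sumFin n (λ k → f (Fin.suc k))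

adjApply : ∀ n → Vect n → Vect n
adjApply n v i j = sumFin n λ i' → sumFin n λ j' → adjMat i j i' j' * v i' j'

InEigenspace : ∀ n → ℚ → Vect n → Set
InEigenspace n λ′ v = ∀ i j → adjApply n v i j ≡ λ′ * v i j

IsEigenvalue : ∀ n → ℚ → Set
IsEigenvalue n λ′ = Σ (Vect n) λ v → InEigenspace n λ′ v × ∃ λ i → ∃ λ j → v i j ≢ 0ℚ

minus4 : ℚ
minus4 = - (+ 4 / 1)

-- X_4, indexed 1-based as in the paper; value 0 outside the listed cells
-- (in particular outside [4]^2)
X4 : ℕ → ℕ → ℚ
X4 1 2 = 1ℚ
X4 2 4 = 1ℚ
X4 3 1 = 1ℚ
X4 4 3 = 1ℚ
X4 1 3 = - 1ℚ
X4 2 1 = - 1ℚ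
X4 3 4 = - 1ℚ
X4 4 2 = - 1ℚ
X4 _ _ = 0ℚ

-- X_n^{(a,b)} for (a,b) ∈ [n-3]^2 (0-indexed a b : Fin (n ∸ 3)).
-- Entry (i,j) is X4 (i-a+1) (j-b+1) when i ≥ a and j ≥ b (X4 vanishes
-- automatically if i-a+1 > 4 or j-b+1 > 4), and 0 otherwise.
Xn : ∀ n → Fin (n ∸ 3) → Fin (n ∸ 3) → Vect n
Xn n a b i j =
  if (toℕ a ≤ᵇ toℕ i) ∧ (toℕ b ≤ᵇ toℕ j)
  then X4 (suc (toℕ i ∸ toℕ a)) (suc (toℕ j ∸ toℕ b))
  else 0ℚ

combo : ∀ n → (Fin (n ∸ 3) → Fin (n ∸ 3) → ℚ) → Vect n
combo n c i j =
  sumFin (n ∸ 3) λ a → sumFin (n ∸ 3) λ b → c a b * Xn n a b i j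

IsBasisOfEigenspace : ∀ n → ℚ → Set
IsBasisOfEigenspace n λ′ =
  (∀ a b → InEigenspace n λ′ (Xn n a b))
  × (∀ (c : Fin (n ∸ 3) → Fin (n ∸ 3) → ℚ) →
       (∀ i j → combo n c i j ≡ 0ℚ) → ∀ a b → c a b ≡ 0ℚ)
  × (∀ v → InEigenspace n λ′ v →
       Σ (Fin (n ∸ 3) → Fin (n ∸ 3) → ℚ) λ c → ∀ i j → v i j ≡ combo n c i j)

-- Let A be the adjacency matrix of Q(n).  For any vector y, the entry of (A + 4I) y at a cell
-- is the sum of the four line sums of y (row, column, antidiagonal, diagonal) through that
-- cell, since two distinct cells share at most one line.  Hence ⟨y, (A + 4I) y⟩ is the sum of
-- the squares of all line sums, and E(-4) consists exactly of the vectors whose line sums all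
-- vanish.  Each X^{(a,b)} is such a vector: the +1 and the −1 cells of X4 meet every line
-- equally often.  At the pivot cell (a, b+1), X^{(a',b')} takes the value 1 for
-- (a',b') = (a,b) and 0 for lexicographically larger (a',b'), so the family is unitriangular
-- on the pivots; this gives independence, and every eigenvector agrees on the pivots with
-- some combination of the family.  Finally, a vector with vanishing line sums that is zero
-- on all pivots is zero: its cells can be cleared one at a time, each being the last
-- unknown cell on one of its lines.
{-# OPTIONS --safe #-}
module Submission where

open import Algebra.Bundles using (CommutativeRing)
open import Data.Bool using (Bool; true; false; not; _∧_; _∨_; if_then_else_)
import Data.Bool.Properties as Boolₚ
open import Data.Empty using (⊥-elim)
open import Data.Fin as Fin using (Fin; toℕ; fromℕ<)
import Data.Fin.Properties as Finₚ
import Data.Integer as ℤ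
open import Data.List using (_∷_; [])
open import Data.Nat as ℕ using (ℕ; zero; suc; z≤n; s≤s; _<_; _≤_; _∸_; _≡ᵇ_; _≤ᵇ_)
open import Data.Nat.Induction using (<-rec)
import Data.Nat.Properties as ℕₚ
open import Data.Nat.Tactic.RingSolver using () renaming (solve to solve-ℕ)
open import Data.Product using (_×_; _,_; proj₁; proj₂; Σ-syntax)
open import Data.Rational as ℚ using (ℚ; 0ℚ; 1ℚ; _+_; _*_; _-_; -_; _/_)
import Data.Rational.Properties as ℚₚ
open import Data.Rational.Solver using (module +-*-Solver)
open import Data.Sum using (_⊎_; inj₁; inj₂)
open import Function using (_∘_)
open import Relation.Binary.Definitions using (tri<; tri≈; tri>)
open import Relation.Binary.PropositionalEquality hiding ([_])
open import Relation.Nullary using (yes; no; does; proof)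
open import Relation.Nullary.Decidable using (dec-true; dec-false; True; toWitness)
open import Relation.Nullary.Reflects using (Reflects; ofʸ; ofⁿ)

open import Defs

open import Algebra.Properties.Semiring.Sum (CommutativeRing.semiring ℚₚ.+-*-commutativeRing)
  using (sum; ∑-comm; ∑-distrib-+; sum-cong-≗; *-distribˡ-sum; sum-replicate-zero)
open import Algebra.Properties.Group ℚₚ.+-0-group using (x∙y⁻¹≈ε⇒x≈y)
open +-*-Solver

∑ : ℕ → (ℕ → ℚ) → ℚ
∑ n f = sum {n} λ k → f (toℕ k)

∑-cong : ∀ n {f g : ℕ → ℚ} → (∀ i → i < n → f i ≡ g i) → ∑ n f ≡ ∑ n g
∑-cong n f≗g = sum-cong-≗ {n} λ k → f≗g (toℕ k) (Finₚ.toℕ<n k)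

∑-zero : ∀ n {f : ℕ → ℚ} → (∀ i → i < n → f i ≡ 0ℚ) → ∑ n f ≡ 0ℚ
∑-zero n f≗0 = trans (∑-cong n f≗0) (sum-replicate-zero n)

∑-split : ∀ m k (f : ℕ → ℚ) → ∑ (m ℕ.+ k) f ≡ ∑ m f + ∑ k (λ i → f (m ℕ.+ i))
∑-split zero    k f = sym (ℚₚ.+-identityˡ _)
∑-split (suc m) k f = trans (cong (f 0 +_) (∑-split m k (λ i → f (suc i))))
                            (sym (ℚₚ.+-assoc (f 0) _ _))

∑-window : ∀ n a w {f : ℕ → ℚ} → a ℕ.+ w ≤ n →
  (∀ i → i < a → f i ≡ 0ℚ) → (∀ i → f (a ℕ.+ (w ℕ.+ i)) ≡ 0ℚ) → ∑ n f ≡ ∑ w (λ p → f (a ℕ.+ p))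
∑-window n a w {f} a+w≤n before after = begin
  ∑ n f                                          ≡⟨ cong (λ m → ∑ m f) (sym n≡a+[w+r]) ⟩
  ∑ (a ℕ.+ (w ℕ.+ r)) f                          ≡⟨ ∑-split a (w ℕ.+ r) f ⟩
  ∑ a f + ∑ (w ℕ.+ r) (λ i → f (a ℕ.+ i))        ≡⟨ cong₂ _+_ (∑-zero a before)
                                                             (∑-split w r λ i → f (a ℕ.+ i)) ⟩
  0ℚ + (window + ∑ r (λ i → f (a ℕ.+ (w ℕ.+ i)))) ≡⟨ cong (λ x → 0ℚ + (window + x)) (∑-zero r λ i _ → after i) ⟩
  0ℚ + (window + 0ℚ)                             ≡⟨ solve 1 (λ x → con 0ℚ :+ (x :+ con 0ℚ) := x) refl window ⟩
  window                                         ∎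
  where
  open ≡-Reasoning
  window : ℚ
  window = ∑ w (λ p → f (a ℕ.+ p))
  r : ℕ
  r = n ∸ (a ℕ.+ w)
  n≡a+[w+r] : a ℕ.+ (w ℕ.+ r) ≡ n
  n≡a+[w+r] = trans (sym (ℕₚ.+-assoc a w r)) (ℕₚ.m+[n∸m]≡n a+w≤n)

∑-distrib-- : ∀ n (f g : ℕ → ℚ) → ∑ n (λ i → f i - g i) ≡ ∑ n f - ∑ n g
∑-distrib-- zero    f g = refl
∑-distrib-- (suc n) f g =
  trans (cong (f 0 - g 0 +_) (∑-distrib-- n (λ i → f (suc i)) (λ i → g (suc i))))
        (solve 4 (λ a b c d → (a :- b) :+ (c :- d) := (a :+ c) :- (b :+ d)) refl
               (f 0) (g 0) (∑ n (λ i → f (suc i))) (∑ n (λ i → g (suc i))))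

*-distribˡ-∑ : ∀ n c (f : ℕ → ℚ) → c * ∑ n f ≡ ∑ n (λ i → c * f i)
*-distribˡ-∑ n c f = *-distribˡ-sum {n} c (λ k → f (toℕ k))

∑-single : ∀ n m {f : ℕ → ℚ} → m < n → (∀ i → i < n → i ≢ m → f i ≡ 0ℚ) → ∑ n f ≡ f m
∑-single (suc n) zero    {f} _         f≗0 =
  trans (cong (f 0 +_) (∑-zero n (λ i i<n → f≗0 (suc i) (s≤s i<n) λ ())))
        (ℚₚ.+-identityʳ (f 0))
∑-single (suc n) (suc m) {f} (s≤s m<n) f≗0 =
  trans (cong (_+ ∑ n (λ i → f (suc i))) (f≗0 0 (s≤s z≤n) λ ()))
  (trans (ℚₚ.+-identityˡ _)
         (∑-single n m m<n λ i i<n i≢m → f≗0 (suc i) (s≤s i<n) (i≢m ∘ ℕₚ.suc-injective)))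

∑-nonneg : ∀ n {f : ℕ → ℚ} → (∀ i → 0ℚ ℚ.≤ f i) → 0ℚ ℚ.≤ ∑ n f
∑-nonneg zero    f≥0 = ℚₚ.≤-refl
∑-nonneg (suc n) f≥0 = ℚₚ.+-mono-≤ (f≥0 0) (∑-nonneg n (λ i → f≥0 (suc i)))

+-nonneg⇒zero : ∀ {x y} → 0ℚ ℚ.≤ x → 0ℚ ℚ.≤ y → x + y ≡ 0ℚ → x ≡ 0ℚ × y ≡ 0ℚ
+-nonneg⇒zero {x} {y} x≥0 y≥0 x+y≡0 = ℚₚ.≤-antisym x≤0 x≥0 , ℚₚ.≤-antisym y≤0 y≥0
  where
  x≤0 : x ℚ.≤ 0ℚ
  x≤0 = subst₂ ℚ._≤_ (ℚₚ.+-identityʳ x) x+y≡0 (ℚₚ.+-monoʳ-≤ x y≥0)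
  y≤0 : y ℚ.≤ 0ℚ
  y≤0 = subst₂ ℚ._≤_ (ℚₚ.+-identityˡ y) x+y≡0 (ℚₚ.+-monoˡ-≤ y x≥0)

∑-nonneg⇒zero : ∀ n {f : ℕ → ℚ} → (∀ i → 0ℚ ℚ.≤ f i) → ∑ n f ≡ 0ℚ → ∀ i → i < n → f i ≡ 0ℚ
∑-nonneg⇒zero (suc n) f≥0 ∑≡0 zero    _         =
  proj₁ (+-nonneg⇒zero (f≥0 0) (∑-nonneg n (f≥0 ∘ suc)) ∑≡0)
∑-nonneg⇒zero (suc n) f≥0 ∑≡0 (suc i) (s≤s i<n) =
  ∑-nonneg⇒zero n (f≥0 ∘ suc) (proj₂ (+-nonneg⇒zero (f≥0 0) (∑-nonneg n (f≥0 ∘ suc)) ∑≡0)) i i<n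

square-positive : ∀ {x} → x ≢ 0ℚ → 0ℚ ℚ.< x * x
square-positive {x} x≢0 with ℚₚ.<-cmp x 0ℚ
... | tri< x<0 _ _ = ℚₚ.positive⁻¹ _ {{ℚₚ.neg*neg⇒pos x {{ℚ.negative x<0}} x {{ℚ.negative x<0}}}}
... | tri≈ _ x≡0 _ = ⊥-elim (x≢0 x≡0)
... | tri> _ _ x>0 = ℚₚ.positive⁻¹ _ {{ℚₚ.pos*pos⇒pos x {{ℚ.positive x>0}} x {{ℚ.positive x>0}}}}

square-nonneg : ∀ x → 0ℚ ℚ.≤ x * x
square-nonneg x with x ℚₚ.≟ 0ℚ
... | yes refl = ℚₚ.≤-refl
... | no  x≢0  = ℚₚ.<⇒≤ (square-positive x≢0)

square≡0⇒≡0 : ∀ x → x * x ≡ 0ℚ → x ≡ 0ℚ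
square≡0⇒≡0 x x²≡0 with x ℚₚ.≟ 0ℚ
... | yes x≡0 = x≡0
... | no  x≢0 = ⊥-elim (ℚₚ.<⇒≢ (square-positive x≢0) (sym x²≡0))

∑∑ : ℕ → (ℕ → ℕ → ℚ) → ℚ
∑∑ n f = ∑ n λ i → ∑ n λ j → f i j

∑∑-cong : ∀ n {f g : ℕ → ℕ → ℚ} → (∀ i j → i < n → j < n → f i j ≡ g i j) → ∑∑ n f ≡ ∑∑ n g
∑∑-cong n f≗g = ∑-cong n λ i i<n → ∑-cong n λ j j<n → f≗g i j i<n j<n

∑∑-zero : ∀ n {f : ℕ → ℕ → ℚ} → (∀ i j → i < n → j < n → f i j ≡ 0ℚ) → ∑∑ n f ≡ 0ℚ
∑∑-zero n f≗0 = ∑-zero n λ i i<n → ∑-zero n λ j j<n → f≗0 i j i<n j<n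

∑∑-distrib-+ : ∀ n (f g : ℕ → ℕ → ℚ) → ∑∑ n (λ i j → f i j + g i j) ≡ ∑∑ n f + ∑∑ n g
∑∑-distrib-+ n f g =
  trans (∑-cong n λ i _ → ∑-distrib-+ {n} (λ j → f i (toℕ j)) (λ j → g i (toℕ j)))
        (∑-distrib-+ {n} (λ i → ∑ n (f (toℕ i))) (λ i → ∑ n (g (toℕ i))))

∑∑-distrib-- : ∀ n (f g : ℕ → ℕ → ℚ) → ∑∑ n (λ i j → f i j - g i j) ≡ ∑∑ n f - ∑∑ n g
∑∑-distrib-- n f g =
  trans (∑-cong n λ i _ → ∑-distrib-- n (f i) (g i))
        (∑-distrib-- n (λ i → ∑ n (f i)) (λ i → ∑ n (g i)))

*-distribˡ-∑∑ : ∀ n c (f : ℕ → ℕ → ℚ) → c * ∑∑ n f ≡ ∑∑ n (λ i j → c * f i j)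
*-distribˡ-∑∑ n c f =
  trans (*-distribˡ-∑ n c (λ i → ∑ n (f i))) (∑-cong n λ i _ → *-distribˡ-∑ n c (f i))

∑∑-single : ∀ n i₀ j₀ {f : ℕ → ℕ → ℚ} → i₀ < n → j₀ < n →
  (∀ i j → i < n → j < n → (i , j) ≢ (i₀ , j₀) → f i j ≡ 0ℚ) → ∑∑ n f ≡ f i₀ j₀
∑∑-single n i₀ j₀ i₀<n j₀<n f≗0 =
  trans (∑-single n i₀ i₀<n λ i i<n i≢i₀ → ∑-zero n λ j j<n → f≗0 i j i<n j<n (i≢i₀ ∘ cong proj₁))
        (∑-single n j₀ j₀<n λ j j<n j≢j₀ → f≗0 i₀ j i₀<n j<n (j≢j₀ ∘ cong proj₂))

∑∑-comm : ∀ n m (f : ℕ → ℕ → ℕ → ℕ → ℚ) →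
  ∑∑ n (λ i j → ∑∑ m (f i j)) ≡ ∑∑ m (λ a b → ∑∑ n (λ i j → f i j a b))
∑∑-comm n m f = begin
  ∑ n (λ i → ∑ n (λ j → ∑ m (λ a → ∑ m (f i j a))))
    ≡⟨ ∑-cong n (λ i _ → ∑-comm {n} {m} λ j a → ∑ m (f i (toℕ j) (toℕ a))) ⟩
  ∑ n (λ i → ∑ m (λ a → ∑ n (λ j → ∑ m (f i j a))))
    ≡⟨ ∑-comm {n} {m} (λ i a → ∑ n (λ j → ∑ m (f (toℕ i) j (toℕ a)))) ⟩
  ∑ m (λ a → ∑ n (λ i → ∑ n (λ j → ∑ m (f i j a))))
    ≡⟨ ∑-cong m (λ a _ → ∑-cong n λ i _ → ∑-comm {n} {m} λ j b → f i (toℕ j) a (toℕ b)) ⟩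
  ∑ m (λ a → ∑ n (λ i → ∑ m (λ b → ∑ n (λ j → f i j a b))))
    ≡⟨ ∑-cong m (λ a _ → ∑-comm {n} {m} λ i b → ∑ n (λ j → f (toℕ i) j a (toℕ b))) ⟩
  ∑ m (λ a → ∑ m (λ b → ∑ n (λ i → ∑ n (λ j → f i j a b)))) ∎
  where open ≡-Reasoning

[_] : Bool → ℚ
[ b ] = if b then 1ℚ else 0ℚ

≡ᵇ-refl : ∀ m → (m ≡ᵇ m) ≡ true
≡ᵇ-refl m = dec-true (m ℕₚ.≟ m) refl

≡ᵇ-≢ : ∀ {m k} → m ≢ k → (m ≡ᵇ k) ≡ false
≡ᵇ-≢ {m} {k} = dec-false (m ℕₚ.≟ k)

≡ᵇ-sym : ∀ m k → (m ≡ᵇ k) ≡ (k ≡ᵇ m)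
≡ᵇ-sym zero    zero    = refl
≡ᵇ-sym zero    (suc k) = refl
≡ᵇ-sym (suc m) zero    = refl
≡ᵇ-sym (suc m) (suc k) = ≡ᵇ-sym m k

≡ᵇ-cong-⇔ : ∀ {x y u v} → (x ≡ y → u ≡ v) → (u ≡ v → x ≡ y) → (x ≡ᵇ y) ≡ (u ≡ᵇ v)
≡ᵇ-cong-⇔ {x} {y} {u} {v} to from with x ℕₚ.≟ y
... | yes x≡y = trans (dec-true (x ℕₚ.≟ y) x≡y) (sym (dec-true (u ℕₚ.≟ v) (to x≡y)))
... | no  x≢y = trans (dec-false (x ℕₚ.≟ y) x≢y) (sym (dec-false (u ℕₚ.≟ v) (x≢y ∘ from)))

∑-δ : ∀ n m (f : ℕ → ℚ) → m < n → ∑ n (λ k → [ m ≡ᵇ k ] * f k) ≡ f m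
∑-δ n m f m<n = begin
  ∑ n (λ k → [ m ≡ᵇ k ] * f k)  ≡⟨ ∑-single n m m<n off-diagonal ⟩
  [ m ≡ᵇ m ] * f m              ≡⟨ cong (λ b → [ b ] * f m) (≡ᵇ-refl m) ⟩
  1ℚ * f m                      ≡⟨ ℚₚ.*-identityˡ (f m) ⟩
  f m                           ∎
  where
  open ≡-Reasoning
  off-diagonal : ∀ k → k < n → k ≢ m → [ m ≡ᵇ k ] * f k ≡ 0ℚ
  off-diagonal k _ k≢m rewrite ≡ᵇ-≢ (k≢m ∘ sym) = ℚₚ.*-zeroˡ (f k)

∑∑-δ : ∀ n a b (f : ℕ → ℕ → ℚ) → a < n → b < n →
  ∑∑ n (λ a' b' → [ (a ≡ᵇ a') ∧ (b ≡ᵇ b') ] * f a' b') ≡ f a b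
∑∑-δ n a b f a<n b<n = begin
  ∑∑ n (λ a' b' → [ (a ≡ᵇ a') ∧ (b ≡ᵇ b') ] * f a' b')
    ≡⟨ ∑-cong n (λ a' _ → ∑-cong n λ b' _ → [∧]≡[]*[] (a ≡ᵇ a') (b ≡ᵇ b') (f a' b')) ⟩
  ∑ n (λ a' → ∑ n λ b' → [ a ≡ᵇ a' ] * ([ b ≡ᵇ b' ] * f a' b'))
    ≡⟨ ∑-cong n (λ a' _ → sym (*-distribˡ-∑ n [ a ≡ᵇ a' ] λ b' → [ b ≡ᵇ b' ] * f a' b')) ⟩
  ∑ n (λ a' → [ a ≡ᵇ a' ] * ∑ n λ b' → [ b ≡ᵇ b' ] * f a' b')
    ≡⟨ ∑-δ n a (λ a' → ∑ n λ b' → [ b ≡ᵇ b' ] * f a' b') a<n ⟩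
  ∑ n (λ b' → [ b ≡ᵇ b' ] * f a b')
    ≡⟨ ∑-δ n b (f a) b<n ⟩
  f a b ∎
  where
  open ≡-Reasoning
  [∧]≡[]*[] : ∀ x y z → [ x ∧ y ] * z ≡ [ x ] * ([ y ] * z)
  [∧]≡[]*[] false y z = trans (ℚₚ.*-zeroˡ z) (sym (ℚₚ.*-zeroˡ ([ y ] * z)))
  [∧]≡[]*[] true  y z = sym (ℚₚ.*-identityˡ ([ y ] * z))

-- Unitriangular systems

_≺_ : ℕ × ℕ → ℕ × ℕ → Set
(a' , b') ≺ (a , b) = a' < a ⊎ (a' ≡ a × b' < b)

≺-rec : (P : ℕ → ℕ → Set) → (∀ a b → (∀ a' b' → (a' , b') ≺ (a , b) → P a' b') → P a b) →
  ∀ a b → P a b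
≺-rec P step = <-rec (λ a → ∀ b → P a b) λ a ih-row →
  <-rec (P a) λ b ih-col → step a b λ where
    a' b' (inj₁ a'<a)          → ih-row a'<a b'
    a' b' (inj₂ (refl , b'<b)) → ih-col b'<b

≺-trichotomous : ∀ a b a' b' → (a' , b') ≢ (a , b) → (a' , b') ≺ (a , b) ⊎ (a , b) ≺ (a' , b')
≺-trichotomous a b a' b' ≢ with ℕₚ.<-cmp a' a | ℕₚ.<-cmp b' b
... | tri< a'<a _ _ | _             = inj₁ (inj₁ a'<a)
... | tri> _ _ a<a' | _             = inj₂ (inj₁ a<a')
... | tri≈ _ refl _ | tri< b'<b _ _ = inj₁ (inj₂ (refl , b'<b))
... | tri≈ _ refl _ | tri≈ _ refl _ = ⊥-elim (≢ refl)
... | tri≈ _ refl _ | tri> _ _ b<b' = inj₂ (inj₂ (refl , b<b'))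

≺-suc : ∀ {a b a' b'} → (a' , b') ≺ (a , suc b) → (a' , b') ≺ (a , b) ⊎ (a' , b') ≡ (a , b)
≺-suc (inj₁ a'<a) = inj₁ (inj₁ a'<a)
≺-suc (inj₂ (a'≡a , b'<1+b)) with ℕₚ.m≤n⇒m<n∨m≡n (ℕₚ.≤-pred b'<1+b)
... | inj₁ b'<b = inj₁ (inj₂ (a'≡a , b'<b))
... | inj₂ b'≡b = inj₂ (cong₂ _,_ a'≡a b'≡b)

module UnitriangularSystem (N : ℕ) (M : ℕ → ℕ → ℕ → ℕ → ℚ)
  (M-diag  : ∀ a b → M a b a b ≡ 1ℚ)
  (M-upper : ∀ a b a' b' → (a , b) ≺ (a' , b') → M a' b' a b ≡ 0ℚ) where

  apply : (ℕ → ℕ → ℚ) → ℕ → ℕ → ℚ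
  apply C a b = ∑∑ N λ a' b' → C a' b' * M a' b' a b

  Vanishes≺ : (ℕ → ℕ → ℚ) → ℕ → ℕ → Set
  Vanishes≺ C a b = ∀ a' b' → a' < N → b' < N → (a' , b') ≺ (a , b) → C a' b' ≡ 0ℚ

  apply-triangular : ∀ C a b → a < N → b < N → Vanishes≺ C a b → apply C a b ≡ C a b
  apply-triangular C a b a<N b<N C≺≡0 = trans (∑∑-single N a b a<N b<N off-diagonal)
    (trans (cong (C a b *_) (M-diag a b)) (ℚₚ.*-identityʳ (C a b)))
    where
    off-diagonal : ∀ a' b' → a' < N → b' < N → (a' , b') ≢ (a , b) → C a' b' * M a' b' a b ≡ 0ℚ
    off-diagonal a' b' a'<N b'<N ≢ with ≺-trichotomous a b a' b' ≢
    ... | inj₁ smaller = trans (cong (_* M a' b' a b) (C≺≡0 a' b' a'<N b'<N smaller))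
                               (ℚₚ.*-zeroˡ (M a' b' a b))
    ... | inj₂ larger  = trans (cong (C a' b' *_) (M-upper a b a' b' larger)) (ℚₚ.*-zeroʳ (C a' b'))

  apply-injective : ∀ C → (∀ a b → a < N → b < N → apply C a b ≡ 0ℚ) →
    ∀ a b → a < N → b < N → C a b ≡ 0ℚ
  apply-injective C apply≡0 = ≺-rec (λ a b → a < N → b < N → C a b ≡ 0ℚ) λ a b ih a<N b<N →
    trans (sym (apply-triangular C a b a<N b<N λ a' b' a'<N b'<N smaller → ih a' b' smaller a'<N b'<N))
          (apply≡0 a b a<N b<N)

  Solved≺ : (ℕ → ℕ → ℚ) → (ℕ → ℕ → ℚ) → ℕ → ℕ → Set
  Solved≺ r C a b = ∀ a' b' → a' < N → b' < N → (a' , b') ≺ (a , b) → apply C a' b' ≡ r a' b'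

  update : (ℕ → ℕ → ℚ) → ℕ → ℕ → ℚ → ℕ → ℕ → ℚ
  update C a b d a' b' = C a' b' + [ (a ≡ᵇ a') ∧ (b ≡ᵇ b') ] * d

  apply-update : ∀ C a b d a″ b″ → a < N → b < N →
    apply (update C a b d) a″ b″ ≡ apply C a″ b″ + d * M a b a″ b″
  apply-update C a b d a″ b″ a<N b<N = begin
    apply (update C a b d) a″ b″
      ≡⟨ ∑∑-cong N (λ a' b' _ _ → solve 4 (λ c δ d m → (c :+ δ :* d) :* m := c :* m :+ δ :* (d :* m))
                                          refl (C a' b') [ (a ≡ᵇ a') ∧ (b ≡ᵇ b') ] d (M a' b' a″ b″)) ⟩
    ∑∑ N (λ a' b' → C a' b' * M a' b' a″ b″ + [ (a ≡ᵇ a') ∧ (b ≡ᵇ b') ] * (d * M a' b' a″ b″))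
      ≡⟨ ∑∑-distrib-+ N (λ a' b' → C a' b' * M a' b' a″ b″)
                        (λ a' b' → [ (a ≡ᵇ a') ∧ (b ≡ᵇ b') ] * (d * M a' b' a″ b″)) ⟩
    apply C a″ b″ + ∑∑ N (λ a' b' → [ (a ≡ᵇ a') ∧ (b ≡ᵇ b') ] * (d * M a' b' a″ b″))
      ≡⟨ cong (apply C a″ b″ +_) (∑∑-δ N a b (λ a' b' → d * M a' b' a″ b″) a<N b<N) ⟩
    apply C a″ b″ + d * M a b a″ b″ ∎
    where open ≡-Reasoning

  -- One step of forward substitution: fix the coefficient at (a , b).
  solve-next : ∀ r C a b → a < N → b < N → Solved≺ r C a b →
    Solved≺ r (update C a b (r a b - apply C a b)) a (suc b)
  solve-next r C a b a<N b<N solved a' b' a'<N b'<N a'b'≺ = by-cases (≺-suc a'b'≺)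
    where
    open ≡-Reasoning
    d : ℚ
    d = r a b - apply C a b
    by-cases : (a' , b') ≺ (a , b) ⊎ (a' , b') ≡ (a , b) → apply (update C a b d) a' b' ≡ r a' b'
    by-cases (inj₁ smaller) = begin
      apply (update C a b d) a' b'    ≡⟨ apply-update C a b d a' b' a<N b<N ⟩
      apply C a' b' + d * M a b a' b' ≡⟨ cong₂ (λ x m → x + d * m) (solved a' b' a'<N b'<N smaller)
                                                                  (M-upper a' b' a b smaller) ⟩
      r a' b' + d * 0ℚ                ≡⟨ solve 2 (λ x d → x :+ d :* con 0ℚ := x) refl (r a' b') d ⟩
      r a' b'                         ∎
    by-cases (inj₂ refl) = begin
      apply (update C a b d) a b      ≡⟨ apply-update C a b d a b a<N b<N ⟩
      apply C a b + d * M a b a b     ≡⟨ cong (λ m → apply C a b + d * m) (M-diag a b) ⟩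
      apply C a b + d * 1ℚ            ≡⟨ solve 2 (λ x y → x :+ (y :- x) :* con 1ℚ := y) refl
                                               (apply C a b) (r a b) ⟩
      r a b                           ∎

  solve-next-row : ∀ r C a → Solved≺ r C a N → Solved≺ r C (suc a) 0
  solve-next-row r C a solved a' b' a'<N b'<N (inj₁ (s≤s a'≤a)) with ℕₚ.m≤n⇒m<n∨m≡n a'≤a
  ... | inj₁ a'<a = solved a' b' a'<N b'<N (inj₁ a'<a)
  ... | inj₂ a'≡a = solved a' b' a'<N b'<N (inj₂ (a'≡a , b'<N))

  solve-row : ∀ r a → a < N → ∀ k b C → b ℕ.+ k ≡ N → Solved≺ r C a b →
    Σ[ C' ∈ (ℕ → ℕ → ℚ) ] Solved≺ r C' a N
  solve-row r a a<N zero    b C b+0≡N solved =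
    C , subst (Solved≺ r C a) (trans (sym (ℕₚ.+-identityʳ b)) b+0≡N) solved
  solve-row r a a<N (suc k) b C b+1+k≡N solved =
    solve-row r a a<N k (suc b) (update C a b (r a b - apply C a b)) (trans (sym (ℕₚ.+-suc b k)) b+1+k≡N)
      (solve-next r C a b a<N (subst (b <_) b+1+k≡N (ℕₚ.m<m+n b (s≤s z≤n))) solved)

  solve-rows : ∀ r a → a ≤ N → Σ[ C ∈ (ℕ → ℕ → ℚ) ] Solved≺ r C a 0
  solve-rows r zero    _   = (λ _ _ → 0ℚ) , λ { _ _ _ _ (inj₁ ()) ; _ _ _ _ (inj₂ (_ , ())) }
  solve-rows r (suc a) a<N with solve-rows r a (ℕₚ.<⇒≤ a<N)
  ... | C , solved with solve-row r a a<N N 0 C refl solved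
  ...   | C' , solved' = C' , solve-next-row r C' a solved'

  apply-surjective : ∀ r → Σ[ C ∈ (ℕ → ℕ → ℚ) ] (∀ a b → a < N → b < N → apply C a b ≡ r a b)
  apply-surjective r with solve-rows r N ℕₚ.≤-refl
  ... | C , solved = C , λ a b a<N b<N → solved a b a<N b<N (inj₁ a<N)

data Direction : Set where
  row col antidiag diag : Direction

∑Dir : (Direction → ℚ) → ℚ
∑Dir f = f row + f col + f antidiag + f diag

∑∑-∑Dir : ∀ n (f : Direction → ℕ → ℕ → ℚ) →
  ∑∑ n (λ i j → ∑Dir (λ d → f d i j)) ≡ ∑Dir (λ d → ∑∑ n (f d))
∑∑-∑Dir n f = begin
  ∑∑ n (λ i j → f row i j + f col i j + f antidiag i j + f diag i j)
    ≡⟨ ∑∑-distrib-+ n (λ i j → f row i j + f col i j + f antidiag i j) (f diag) ⟩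
  ∑∑ n (λ i j → f row i j + f col i j + f antidiag i j) + ∑∑ n (f diag)
    ≡⟨ cong (_+ ∑∑ n (f diag)) (∑∑-distrib-+ n (λ i j → f row i j + f col i j) (f antidiag)) ⟩
  ∑∑ n (λ i j → f row i j + f col i j) + ∑∑ n (f antidiag) + ∑∑ n (f diag)
    ≡⟨ cong (λ x → x + ∑∑ n (f antidiag) + ∑∑ n (f diag)) (∑∑-distrib-+ n (f row) (f col)) ⟩
  ∑Dir (λ d → ∑∑ n (f d)) ∎
  where open ≡-Reasoning

∑Dir-nonneg⇒zero : ∀ {f : Direction → ℚ} → (∀ d → 0ℚ ℚ.≤ f d) → ∑Dir f ≡ 0ℚ → ∀ d → f d ≡ 0ℚ
∑Dir-nonneg⇒zero {f} f≥0 ∑≡0 = λ where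
    row      → proj₁ rc≡0
    col      → proj₂ rc≡0
    antidiag → proj₂ rca≡0
    diag     → proj₂ rcad≡0
  where
  r+c≥0 : 0ℚ ℚ.≤ f row + f col
  r+c≥0 = ℚₚ.+-mono-≤ (f≥0 row) (f≥0 col)
  r+c+a≥0 : 0ℚ ℚ.≤ f row + f col + f antidiag
  r+c+a≥0 = ℚₚ.+-mono-≤ r+c≥0 (f≥0 antidiag)
  rcad≡0 : f row + f col + f antidiag ≡ 0ℚ × f diag ≡ 0ℚ
  rcad≡0 = +-nonneg⇒zero r+c+a≥0 (f≥0 diag) ∑≡0
  rca≡0 : f row + f col ≡ 0ℚ × f antidiag ≡ 0ℚ
  rca≡0 = +-nonneg⇒zero r+c≥0 (f≥0 antidiag) (proj₁ rcad≡0)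
  rc≡0 : f row ≡ 0ℚ × f col ≡ 0ℚ
  rc≡0 = +-nonneg⇒zero (f≥0 row) (f≥0 col) (proj₁ rca≡0)

+-cong₄ : ∀ {a b c d a' b' c' d' : ℚ} → a ≡ a' → b ≡ b' → c ≡ c' → d ≡ d' →
  a + b + c + d ≡ a' + b' + c' + d'
+-cong₄ refl refl refl refl = refl

four : ℚ
four = ℤ.+ 4 / 1

adjacentᵇ : ℕ → ℕ → ℕ → ℕ → Bool
adjacentᵇ i j i' j' = not ((i ≡ᵇ i') ∧ (j ≡ᵇ j'))
  ∧ ((i ≡ᵇ i') ∨ (j ≡ᵇ j') ∨ (i ℕ.+ j ≡ᵇ i' ℕ.+ j') ∨ (i ℕ.+ j' ≡ᵇ i' ℕ.+ j))

-- R, C, A, D: two cells share a row, a column, an antidiagonal, a diagonal.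
shared-lines-count : ∀ {R C A D : Set} {r c a d} →
  Reflects R r → Reflects C c → Reflects A a → Reflects D d →
  (R → C → A × D) → (R → A → C) → (R → D → C) → (C → A → R) → (C → D → R) → (A → D → R) →
  [ r ] + [ c ] + [ a ] + [ d ] ≡ [ not (r ∧ c) ∧ (r ∨ c ∨ a ∨ d) ] + four * [ r ∧ c ]
shared-lines-count (ofʸ r) (ofʸ c) (ofʸ a) (ofʸ d) rc ra rd ca cd ad = refl
shared-lines-count (ofʸ r) (ofʸ c) (ofⁿ a) _       rc ra rd ca cd ad = ⊥-elim (a (proj₁ (rc r c)))
shared-lines-count (ofʸ r) (ofʸ c) (ofʸ a) (ofⁿ d) rc ra rd ca cd ad = ⊥-elim (d (proj₂ (rc r c)))
shared-lines-count (ofʸ r) (ofⁿ c) (ofʸ a) _       rc ra rd ca cd ad = ⊥-elim (c (ra r a))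
shared-lines-count (ofʸ r) (ofⁿ c) (ofⁿ a) (ofʸ d) rc ra rd ca cd ad = ⊥-elim (c (rd r d))
shared-lines-count (ofʸ r) (ofⁿ c) (ofⁿ a) (ofⁿ d) rc ra rd ca cd ad = refl
shared-lines-count (ofⁿ r) (ofʸ c) (ofʸ a) _       rc ra rd ca cd ad = ⊥-elim (r (ca c a))
shared-lines-count (ofⁿ r) (ofʸ c) (ofⁿ a) (ofʸ d) rc ra rd ca cd ad = ⊥-elim (r (cd c d))
shared-lines-count (ofⁿ r) (ofʸ c) (ofⁿ a) (ofⁿ d) rc ra rd ca cd ad = refl
shared-lines-count (ofⁿ r) (ofⁿ c) (ofʸ a) (ofʸ d) rc ra rd ca cd ad = ⊥-elim (r (ad a d))
shared-lines-count (ofⁿ r) (ofⁿ c) (ofʸ a) (ofⁿ d) rc ra rd ca cd ad = refl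
shared-lines-count (ofⁿ r) (ofⁿ c) (ofⁿ a) (ofʸ d) rc ra rd ca cd ad = refl
shared-lines-count (ofⁿ r) (ofⁿ c) (ofⁿ a) (ofⁿ d) rc ra rd ca cd ad = refl

+≡+⇒< : ∀ {i x r c} → r < i → i ℕ.+ x ≡ r ℕ.+ c → x < c
+≡+⇒< {i} {x} {r} {c} r<i i+x≡r+c = ℕₚ.≰⇒> λ c≤x →
  ℕₚ.<-irrefl (sym i+x≡r+c) (ℕₚ.+-mono-<-≤ r<i c≤x)

antidiag-diag-meet-once : ∀ {i j i' j'} → i ℕ.+ j ≡ i' ℕ.+ j' → i ℕ.+ j' ≡ i' ℕ.+ j → i ≡ i'
antidiag-diag-meet-once {i} {j} {i'} {j'} anti dia with ℕₚ.<-cmp i i'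
... | tri< i<i' _ _ = ⊥-elim (ℕₚ.<-asym (+≡+⇒< i<i' (sym anti)) (+≡+⇒< i<i' (sym dia)))
... | tri≈ _ i≡i' _ = i≡i'
... | tri> _ _ i'<i = ⊥-elim (ℕₚ.<-asym (+≡+⇒< i'<i anti) (+≡+⇒< i'<i dia))

-- The vectors X_n^{(a,b)}

-- X a b is the vector X_n^{(a+1,b+1)} of the paper, with 0-based indices.
X : ℕ → ℕ → ℕ → ℕ → ℚ
X a b i j = if (a ≤ᵇ i) ∧ (b ≤ᵇ j) then X4 (suc (i ∸ a)) (suc (j ∸ b)) else 0ℚ

X-window : ∀ a b p q → X a b (a ℕ.+ p) (b ℕ.+ q) ≡ X4 (suc p) (suc q)
X-window a b p q
  rewrite dec-true (a ℕₚ.≤? a ℕ.+ p) (ℕₚ.m≤m+n a p) | dec-true (b ℕₚ.≤? b ℕ.+ q) (ℕₚ.m≤m+n b q)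
        | ℕₚ.m+n∸m≡n a p | ℕₚ.m+n∸m≡n b q = refl

X-above : ∀ {a} b {i} j → i < a → X a b i j ≡ 0ℚ
X-above {a} b {i} j i<a rewrite dec-false (a ℕₚ.≤? i) (ℕₚ.<⇒≱ i<a) = refl

X-below : ∀ a b i j → X a b (a ℕ.+ (4 ℕ.+ i)) j ≡ 0ℚ
X-below a b i j
  rewrite dec-true (a ℕₚ.≤? a ℕ.+ (4 ℕ.+ i)) (ℕₚ.m≤m+n a (4 ℕ.+ i)) | ℕₚ.m+n∸m≡n a (4 ℕ.+ i)
  with b ≤ᵇ j
... | true  = refl
... | false = refl

X-left : ∀ a {b} i {j} → j < b → X a b i j ≡ 0ℚ
X-left a {b} i {j} j<b rewrite dec-false (b ℕₚ.≤? j) (ℕₚ.<⇒≱ j<b) | Boolₚ.∧-zeroʳ (a ≤ᵇ i) = refl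

X-right : ∀ a b i j → X a b i (b ℕ.+ (4 ℕ.+ j)) ≡ 0ℚ
X-right a b i j
  rewrite dec-true (b ℕₚ.≤? b ℕ.+ (4 ℕ.+ j)) (ℕₚ.m≤m+n b (4 ℕ.+ j)) | ℕₚ.m+n∸m≡n b (4 ℕ.+ j)
        | Boolₚ.∧-identityʳ (a ≤ᵇ i)
  with a ≤ᵇ i
... | false = refl
... | true  = X4-beyond (i ∸ a)
  where
  X4-beyond : ∀ p → X4 (suc p) (5 ℕ.+ j) ≡ 0ℚ
  X4-beyond 0 = refl
  X4-beyond 1 = refl
  X4-beyond 2 = refl
  X4-beyond 3 = refl
  X4-beyond (suc (suc (suc (suc p)))) = refl

X-pivot : ∀ a b → X a b a (suc b) ≡ 1ℚ
X-pivot a b = subst₂ (λ i j → X a b i j ≡ 1ℚ) (ℕₚ.+-identityʳ a) (ℕₚ.+-comm b 1) (X-window a b 0 1)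

X-beyond-pivot : ∀ a b a' b' → (a , b) ≺ (a' , b') → X a' b' a (suc b) ≡ 0ℚ
X-beyond-pivot a b a' b' (inj₁ a<a') = X-above b' (suc b) a<a'
X-beyond-pivot a b a' b' (inj₂ (refl , b<b')) with ℕₚ.m≤n⇒m<n∨m≡n b<b'
... | inj₁ 1+b<b' = X-left a a 1+b<b'
... | inj₂ refl   = subst₂ (λ i j → X a (suc b) i j ≡ 0ℚ) (ℕₚ.+-identityʳ a) (ℕₚ.+-identityʳ (suc b))
                           (X-window a (suc b) 0 0)

-- Sums of h over the +1 cells and over the −1 cells of X4, at 0-based offsets.
∑X4⁺ ∑X4⁻ : (ℕ → ℕ → ℚ) → ℚ
∑X4⁺ h = h 0 1 + h 1 3 + h 2 0 + h 3 2
∑X4⁻ h = h 0 2 + h 1 0 + h 2 3 + h 3 1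

∑-X4 : ∀ (h : ℕ → ℕ → ℚ) → ∑ 4 (λ p → ∑ 4 λ q → h p q * X4 (suc p) (suc q)) ≡ ∑X4⁺ h - ∑X4⁻ h
∑-X4 h = solve 16 (λ h00 h01 h02 h03 h10 h11 h12 h13 h20 h21 h22 h23 h30 h31 h32 h33 →
    rowTerms h00 (con 0ℚ) h01 (con 1ℚ) h02 (con (- 1ℚ)) h03 (con 0ℚ)
    :+ (rowTerms h10 (con (- 1ℚ)) h11 (con 0ℚ) h12 (con 0ℚ) h13 (con 1ℚ)
    :+ (rowTerms h20 (con 1ℚ) h21 (con 0ℚ) h22 (con 0ℚ) h23 (con (- 1ℚ))
    :+ (rowTerms h30 (con 0ℚ) h31 (con (- 1ℚ)) h32 (con 1ℚ) h33 (con 0ℚ) :+ con 0ℚ)))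
    := (h01 :+ h13 :+ h20 :+ h32) :- (h02 :+ h10 :+ h23 :+ h31)) refl
    (h 0 0) (h 0 1) (h 0 2) (h 0 3) (h 1 0) (h 1 1) (h 1 2) (h 1 3)
    (h 2 0) (h 2 1) (h 2 2) (h 2 3) (h 3 0) (h 3 1) (h 3 2) (h 3 3)
  where
  -- The shape of ∑ 4 (λ q → …) unfolded, with the entries of a row of X4 as constants.
  rowTerms : ∀ {m} → (x₀ c₀ x₁ c₁ x₂ c₂ x₃ c₃ : Polynomial m) → Polynomial m
  rowTerms x₀ c₀ x₁ c₁ x₂ c₂ x₃ c₃ = x₀ :* c₀ :+ (x₁ :* c₁ :+ (x₂ :* c₂ :+ (x₃ :* c₃ :+ con 0ℚ)))

-- The queens' graph

module Board (n : ℕ) where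

  -- The diagonal i - j = c is labelled by i + (n ∸ j), which keeps labels in ℕ.
  label : Direction → ℕ → ℕ → ℕ
  label row      i j = i
  label col      i j = j
  label antidiag i j = i ℕ.+ j
  label diag     i j = i ℕ.+ (n ∸ j)

  label<2n : ∀ d {i j} → i < n → j < n → label d i j < n ℕ.+ n
  label<2n row      i<n _   = ℕₚ.<-≤-trans i<n (ℕₚ.m≤m+n n n)
  label<2n col      _   j<n = ℕₚ.<-≤-trans j<n (ℕₚ.m≤m+n n n)
  label<2n antidiag i<n j<n = ℕₚ.+-mono-<-≤ i<n (ℕₚ.<⇒≤ j<n)
  label<2n diag {j = j} i<n _ = ℕₚ.+-mono-<-≤ i<n (ℕₚ.m∸n≤m n j)

  diag-shift : ∀ i j j' → j ≤ n → label diag i j ℕ.+ (j ℕ.+ j') ≡ i ℕ.+ j' ℕ.+ n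
  diag-shift i j j' j≤n = begin
    i ℕ.+ (n ∸ j) ℕ.+ (j ℕ.+ j') ≡⟨ rearrange i (n ∸ j) j j' ⟩
    i ℕ.+ j' ℕ.+ (n ∸ j ℕ.+ j)   ≡⟨ cong (i ℕ.+ j' ℕ.+_) (ℕₚ.m∸n+n≡m j≤n) ⟩
    i ℕ.+ j' ℕ.+ n               ∎
    where
    open ≡-Reasoning
    rearrange : ∀ a b c d → a ℕ.+ b ℕ.+ (c ℕ.+ d) ≡ a ℕ.+ d ℕ.+ (b ℕ.+ c)
    rearrange a b c d = solve-ℕ (a ∷ b ∷ c ∷ d ∷ [])

  diag-label-≡⇔ : ∀ {i j i' j'} → j ≤ n → j' ≤ n →
    (label diag i j ≡ label diag i' j' → i ℕ.+ j' ≡ i' ℕ.+ j) ×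
    (i ℕ.+ j' ≡ i' ℕ.+ j → label diag i j ≡ label diag i' j')
  diag-label-≡⇔ {i} {j} {i'} {j'} j≤n j'≤n = to , from
    where
    shift' : label diag i' j' ℕ.+ (j ℕ.+ j') ≡ i' ℕ.+ j ℕ.+ n
    shift' = trans (cong (label diag i' j' ℕ.+_) (ℕₚ.+-comm j j')) (diag-shift i' j' j j'≤n)
    to : label diag i j ≡ label diag i' j' → i ℕ.+ j' ≡ i' ℕ.+ j
    to same = ℕₚ.+-cancelʳ-≡ n _ _
      (trans (sym (diag-shift i j j' j≤n)) (trans (cong (ℕ._+ (j ℕ.+ j')) same) shift'))
    from : i ℕ.+ j' ≡ i' ℕ.+ j → label diag i j ≡ label diag i' j'
    from same = ℕₚ.+-cancelʳ-≡ (j ℕ.+ j') _ _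
      (trans (diag-shift i j j' j≤n) (trans (cong (ℕ._+ n) same) (sym shift')))

  shared-lines : ∀ i j i' j' → j ≤ n → j' ≤ n →
    ∑Dir (λ d → [ label d i j ≡ᵇ label d i' j' ]) ≡ [ adjacentᵇ i j i' j' ] + four * [ (i ≡ᵇ i') ∧ (j ≡ᵇ j') ]
  shared-lines i j i' j' j≤n j'≤n
    rewrite ≡ᵇ-cong-⇔ (proj₁ (diag-label-≡⇔ {i} {j} {i'} {j'} j≤n j'≤n)) (proj₂ (diag-label-≡⇔ j≤n j'≤n)) =
    shared-lines-count (proof (i ℕₚ.≟ i')) (proof (j ℕₚ.≟ j'))
                       (proof (i ℕ.+ j ℕₚ.≟ i' ℕ.+ j')) (proof (i ℕ.+ j' ℕₚ.≟ i' ℕ.+ j))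
      (λ i≡i' j≡j' → cong₂ ℕ._+_ i≡i' j≡j' , cong₂ ℕ._+_ i≡i' (sym j≡j'))
      (λ i≡i' anti → ℕₚ.+-cancelˡ-≡ i j j' (trans anti (cong (ℕ._+ j') (sym i≡i'))))
      (λ i≡i' dia → sym (ℕₚ.+-cancelˡ-≡ i j' j (trans dia (cong (ℕ._+ j) (sym i≡i')))))
      (λ j≡j' anti → ℕₚ.+-cancelʳ-≡ j i i' (trans anti (cong (i' ℕ.+_) (sym j≡j'))))
      (λ j≡j' dia → ℕₚ.+-cancelʳ-≡ j i i' (trans (cong (i ℕ.+_) j≡j') dia))
      antidiag-diag-meet-once

  lineSum : Direction → (ℕ → ℕ → ℚ) → ℕ → ℚ
  lineSum d y k = ∑∑ n λ i j → [ k ≡ᵇ label d i j ] * y i j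

  adjacency : (ℕ → ℕ → ℚ) → ℕ → ℕ → ℚ
  adjacency y i j = ∑∑ n λ i' j' → [ adjacentᵇ i j i' j' ] * y i' j'

  lineSum-distrib-- : ∀ d y w k → lineSum d (λ i j → y i j - w i j) k ≡ lineSum d y k - lineSum d w k
  lineSum-distrib-- d y w k =
    trans (∑∑-cong n λ i j _ _ → solve 3 (λ g y w → g :* (y :- w) := g :* y :- g :* w) refl
                                         [ k ≡ᵇ label d i j ] (y i j) (w i j))
          (∑∑-distrib-- n (λ i j → [ k ≡ᵇ label d i j ] * y i j) (λ i j → [ k ≡ᵇ label d i j ] * w i j))

  adjacency+4≡∑lineSums : ∀ y i j → i < n → j < n →
    adjacency y i j + four * y i j ≡ ∑Dir (λ d → lineSum d y (label d i j))
  adjacency+4≡∑lineSums y i j i<n j<n = sym (begin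
    ∑Dir (λ d → lineSum d y (label d i j))
      ≡⟨ sym (∑∑-∑Dir n λ d i' j' → [ label d i j ≡ᵇ label d i' j' ] * y i' j') ⟩
    ∑∑ n (λ i' j' → ∑Dir λ d → [ label d i j ≡ᵇ label d i' j' ] * y i' j')
      ≡⟨ ∑∑-cong n (λ i' j' _ j'<n → regroup i' j' (ℕₚ.<⇒≤ j'<n)) ⟩
    ∑∑ n (λ i' j' → [ adjacentᵇ i j i' j' ] * y i' j' + four * ([ δ i' j' ] * y i' j'))
      ≡⟨ ∑∑-distrib-+ n (λ i' j' → [ adjacentᵇ i j i' j' ] * y i' j')
                        (λ i' j' → four * ([ δ i' j' ] * y i' j')) ⟩
    adjacency y i j + ∑∑ n (λ i' j' → four * ([ δ i' j' ] * y i' j'))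
      ≡⟨ cong (adjacency y i j +_) (sym (*-distribˡ-∑∑ n four λ i' j' → [ δ i' j' ] * y i' j')) ⟩
    adjacency y i j + four * ∑∑ n (λ i' j' → [ δ i' j' ] * y i' j')
      ≡⟨ cong (λ x → adjacency y i j + four * x) (∑∑-δ n i j y i<n j<n) ⟩
    adjacency y i j + four * y i j ∎)
    where
    open ≡-Reasoning
    δ : ℕ → ℕ → Bool
    δ i' j' = (i ≡ᵇ i') ∧ (j ≡ᵇ j')
    regroup : ∀ i' j' → j' ≤ n → ∑Dir (λ d → [ label d i j ≡ᵇ label d i' j' ] * y i' j')
                                ≡ [ adjacentᵇ i j i' j' ] * y i' j' + four * ([ δ i' j' ] * y i' j')
    regroup i' j' j'≤n = begin
      ∑Dir (λ d → [ label d i j ≡ᵇ label d i' j' ] * y i' j')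
        ≡⟨ solve 5 (λ r c a d y → r :* y :+ c :* y :+ a :* y :+ d :* y := (r :+ c :+ a :+ d) :* y) refl
             [ label row i j ≡ᵇ label row i' j' ] [ label col i j ≡ᵇ label col i' j' ]
             [ label antidiag i j ≡ᵇ label antidiag i' j' ] [ label diag i j ≡ᵇ label diag i' j' ] (y i' j') ⟩
      ∑Dir (λ d → [ label d i j ≡ᵇ label d i' j' ]) * y i' j'
        ≡⟨ cong (_* y i' j') (shared-lines i j i' j' (ℕₚ.<⇒≤ j<n) j'≤n) ⟩
      ([ adjacentᵇ i j i' j' ] + four * [ δ i' j' ]) * y i' j'
        ≡⟨ solve 4 (λ a f δ y → (a :+ f :* δ) :* y := a :* y :+ f :* (δ :* y)) refl
             [ adjacentᵇ i j i' j' ] four [ δ i' j' ] (y i' j') ⟩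
      [ adjacentᵇ i j i' j' ] * y i' j' + four * ([ δ i' j' ] * y i' j') ∎

  ∑-lineSum² : ∀ d y → ∑∑ n (λ i j → y i j * lineSum d y (label d i j))
                      ≡ ∑ (n ℕ.+ n) (λ k → lineSum d y k * lineSum d y k)
  ∑-lineSum² d y = begin
    ∑∑ n (λ i j → y i j * S (label d i j))
      ≡⟨ ∑∑-cong n (λ i j i<n j<n → cong (y i j *_)
                      (sym (∑-δ (n ℕ.+ n) (label d i j) S (label<2n d i<n j<n)))) ⟩
    ∑∑ n (λ i j → y i j * ∑ (n ℕ.+ n) (λ k → [ label d i j ≡ᵇ k ] * S k))
      ≡⟨ ∑∑-cong n (λ i j _ _ → trans (*-distribˡ-∑ (n ℕ.+ n) (y i j) λ k → [ label d i j ≡ᵇ k ] * S k)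
                                      (∑-cong (n ℕ.+ n) λ k _ → rearrange i j k)) ⟩
    ∑ n (λ i → ∑ n λ j → ∑ (n ℕ.+ n) λ k → S k * ([ k ≡ᵇ label d i j ] * y i j))
      ≡⟨ ∑-cong n (λ i _ → ∑-comm {n} {n ℕ.+ n}
                      λ j k → S (toℕ k) * ([ toℕ k ≡ᵇ label d i (toℕ j) ] * y i (toℕ j))) ⟩
    ∑ n (λ i → ∑ (n ℕ.+ n) λ k → ∑ n λ j → S k * ([ k ≡ᵇ label d i j ] * y i j))
      ≡⟨ ∑-comm {n} {n ℕ.+ n} (λ i k → ∑ n λ j → S (toℕ k) * ([ toℕ k ≡ᵇ label d (toℕ i) j ] * y (toℕ i) j)) ⟩
    ∑ (n ℕ.+ n) (λ k → ∑∑ n λ i j → S k * ([ k ≡ᵇ label d i j ] * y i j))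
      ≡⟨ ∑-cong (n ℕ.+ n) (λ k _ → sym (*-distribˡ-∑∑ n (S k) λ i j → [ k ≡ᵇ label d i j ] * y i j)) ⟩
    ∑ (n ℕ.+ n) (λ k → S k * S k) ∎
    where
    open ≡-Reasoning
    S : ℕ → ℚ
    S = lineSum d y
    rearrange : ∀ i j k → y i j * ([ label d i j ≡ᵇ k ] * S k) ≡ S k * ([ k ≡ᵇ label d i j ] * y i j)
    rearrange i j k rewrite ≡ᵇ-sym (label d i j) k =
      solve 3 (λ y b s → y :* (b :* s) := s :* (b :* y)) refl (y i j) [ k ≡ᵇ label d i j ] (S k)

  LineSumsVanish : (ℕ → ℕ → ℚ) → Set
  LineSumsVanish y = ∀ d i j → i < n → j < n → lineSum d y (label d i j) ≡ 0ℚ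

  Eigenvector-4 : (ℕ → ℕ → ℚ) → Set
  Eigenvector-4 y = ∀ i j → i < n → j < n → adjacency y i j ≡ minus4 * y i j

  lineSumsVanish⇒eigenvector : ∀ y → LineSumsVanish y → Eigenvector-4 y
  lineSumsVanish⇒eigenvector y vanish i j i<n j<n = begin
    adjacency y i j
      ≡⟨ solve 3 (λ a f y → a := (a :+ f :* y) :+ (:- f) :* y) refl (adjacency y i j) four (y i j) ⟩
    (adjacency y i j + four * y i j) + minus4 * y i j
      ≡⟨ cong (_+ minus4 * y i j) (adjacency+4≡∑lineSums y i j i<n j<n) ⟩
    ∑Dir (λ d → lineSum d y (label d i j)) + minus4 * y i j
      ≡⟨ cong (_+ minus4 * y i j) ∑≡0 ⟩
    0ℚ + minus4 * y i j
      ≡⟨ ℚₚ.+-identityˡ _ ⟩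
    minus4 * y i j ∎
    where
    open ≡-Reasoning
    ∑≡0 : ∑Dir (λ d → lineSum d y (label d i j)) ≡ 0ℚ
    ∑≡0 rewrite vanish row i j i<n j<n | vanish col i j i<n j<n
              | vanish antidiag i j i<n j<n | vanish diag i j i<n j<n = refl

  -- ⟨y, (A + 4I) y⟩ is the sum of the squares of all line sums of y.
  eigenvector⇒lineSumsVanish : ∀ y → Eigenvector-4 y → LineSumsVanish y
  eigenvector⇒lineSumsVanish y eigen d i j i<n j<n =
    square≡0⇒≡0 _ (∑-nonneg⇒zero (n ℕ.+ n) (λ k → square-nonneg (lineSum d y k))
                    (∑Dir-nonneg⇒zero (λ d → ∑-nonneg (n ℕ.+ n) λ k → square-nonneg (lineSum d y k)) total d)
                    (label d i j) (label<2n d i<n j<n))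
    where
    open ≡-Reasoning
    total : ∑Dir (λ d → ∑ (n ℕ.+ n) λ k → lineSum d y k * lineSum d y k) ≡ 0ℚ
    total = begin
      ∑Dir (λ d → ∑ (n ℕ.+ n) λ k → lineSum d y k * lineSum d y k)
        ≡⟨ sym (+-cong₄ (∑-lineSum² row y) (∑-lineSum² col y) (∑-lineSum² antidiag y) (∑-lineSum² diag y)) ⟩
      ∑Dir (λ d → ∑∑ n λ i j → y i j * lineSum d y (label d i j))
        ≡⟨ sym (∑∑-∑Dir n λ d i j → y i j * lineSum d y (label d i j)) ⟩
      ∑∑ n (λ i j → ∑Dir λ d → y i j * lineSum d y (label d i j))
        ≡⟨ ∑∑-cong n (λ i j i<n j<n → vanishes i j i<n j<n) ⟩
      ∑∑ n (λ _ _ → 0ℚ)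
        ≡⟨ ∑∑-zero n (λ _ _ _ _ → refl) ⟩
      0ℚ ∎
      where
      vanishes : ∀ i j → i < n → j < n → ∑Dir (λ d → y i j * lineSum d y (label d i j)) ≡ 0ℚ
      vanishes i j i<n j<n = begin
        ∑Dir (λ d → y i j * lineSum d y (label d i j))
          ≡⟨ solve 5 (λ y a b c d → y :* a :+ y :* b :+ y :* c :+ y :* d := y :* (a :+ b :+ c :+ d)) refl
               (y i j) (lineSum row y i) (lineSum col y j)
               (lineSum antidiag y (i ℕ.+ j)) (lineSum diag y (label diag i j)) ⟩
        y i j * ∑Dir (λ d → lineSum d y (label d i j))
          ≡⟨ cong (y i j *_) (sym (adjacency+4≡∑lineSums y i j i<n j<n)) ⟩
        y i j * (adjacency y i j + four * y i j)
          ≡⟨ cong (λ a → y i j * (a + four * y i j)) (eigen i j i<n j<n) ⟩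
        y i j * (minus4 * y i j + four * y i j)
          ≡⟨ solve 2 (λ y f → y :* ((:- f) :* y :+ f :* y) := con 0ℚ) refl (y i j) four ⟩
        0ℚ ∎

  ∑∑-X : ∀ a b (g : ℕ → ℕ → ℚ) → a ℕ.+ 4 ≤ n → b ℕ.+ 4 ≤ n →
    ∑∑ n (λ i j → g i j * X a b i j)
      ≡ ∑X4⁺ (λ p q → g (a ℕ.+ p) (b ℕ.+ q)) - ∑X4⁻ (λ p q → g (a ℕ.+ p) (b ℕ.+ q))
  ∑∑-X a b g a+4≤n b+4≤n = begin
    ∑ n (λ i → ∑ n λ j → g i j * X a b i j)
      ≡⟨ ∑-window n a 4 a+4≤n (λ i i<a → ∑-zero n λ j _ → vanish (X-above b j i<a))
                             (λ i → ∑-zero n λ j _ → vanish (X-below a b i j)) ⟩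
    ∑ 4 (λ p → ∑ n λ j → g (a ℕ.+ p) j * X a b (a ℕ.+ p) j)
      ≡⟨ ∑-cong 4 (λ p _ → ∑-window n b 4 b+4≤n (λ j j<b → vanish (X-left a (a ℕ.+ p) j<b))
                                                (λ j → vanish (X-right a b (a ℕ.+ p) j))) ⟩
    ∑ 4 (λ p → ∑ 4 λ q → g (a ℕ.+ p) (b ℕ.+ q) * X a b (a ℕ.+ p) (b ℕ.+ q))
      ≡⟨ ∑-cong 4 (λ p _ → ∑-cong 4 λ q _ → cong (g (a ℕ.+ p) (b ℕ.+ q) *_) (X-window a b p q)) ⟩
    ∑ 4 (λ p → ∑ 4 λ q → g (a ℕ.+ p) (b ℕ.+ q) * X4 (suc p) (suc q))
      ≡⟨ ∑-X4 (λ p q → g (a ℕ.+ p) (b ℕ.+ q)) ⟩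
    ∑X4⁺ (λ p q → g (a ℕ.+ p) (b ℕ.+ q)) - ∑X4⁻ (λ p q → g (a ℕ.+ p) (b ℕ.+ q)) ∎
    where
    open ≡-Reasoning
    vanish : ∀ {i j} → X a b i j ≡ 0ℚ → g i j * X a b i j ≡ 0ℚ
    vanish {i} {j} X≡0 = trans (cong (g i j *_) X≡0) (ℚₚ.*-zeroʳ (g i j))

  X4-balanced : ∀ d k a b → b ℕ.+ 4 ≤ n →
    ∑X4⁺ (λ p q → [ k ≡ᵇ label d (a ℕ.+ p) (b ℕ.+ q) ]) ≡ ∑X4⁻ (λ p q → [ k ≡ᵇ label d (a ℕ.+ p) (b ℕ.+ q) ])
  X4-balanced row      k a b _ = refl
  X4-balanced col      k a b _ =
    solve 4 (λ x₀ x₁ x₂ x₃ → x₁ :+ x₃ :+ x₀ :+ x₂ := x₂ :+ x₀ :+ x₃ :+ x₁) refl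
          [ k ≡ᵇ b ℕ.+ 0 ] [ k ≡ᵇ b ℕ.+ 1 ] [ k ≡ᵇ b ℕ.+ 2 ] [ k ≡ᵇ b ℕ.+ 3 ]
  X4-balanced antidiag k a b _ = sym (begin
    h 0 2 + h 1 0 + h 2 3 + h 3 1
      ≡⟨ +-cong₄ (same 0 2 2 0 (solve-ℕ (a ∷ b ∷ []))) (same 1 0 0 1 (solve-ℕ (a ∷ b ∷ [])))
                 (same 2 3 3 2 (solve-ℕ (a ∷ b ∷ []))) (same 3 1 1 3 (solve-ℕ (a ∷ b ∷ []))) ⟩
    h 2 0 + h 0 1 + h 3 2 + h 1 3
      ≡⟨ solve 4 (λ x y z w → z :+ x :+ w :+ y := x :+ y :+ z :+ w) refl (h 0 1) (h 1 3) (h 2 0) (h 3 2) ⟩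
    h 0 1 + h 1 3 + h 2 0 + h 3 2 ∎)
    where
    open ≡-Reasoning
    h : ℕ → ℕ → ℚ
    h p q = [ k ≡ᵇ label antidiag (a ℕ.+ p) (b ℕ.+ q) ]
    same : ∀ p q p' q' → a ℕ.+ p ℕ.+ (b ℕ.+ q) ≡ a ℕ.+ p' ℕ.+ (b ℕ.+ q') → h p q ≡ h p' q'
    same p q p' q' eq = cong (λ m → [ k ≡ᵇ m ]) eq
  X4-balanced diag k a b b+4≤n = sym (begin
    h 0 2 + h 1 0 + h 2 3 + h 3 1
      ≡⟨ +-cong₄ (same 0 2 1 3 (solve-ℕ (a ∷ b ∷ []))) (same 1 0 3 2 (solve-ℕ (a ∷ b ∷ [])))
                 (same 2 3 0 1 (solve-ℕ (a ∷ b ∷ []))) (same 3 1 2 0 (solve-ℕ (a ∷ b ∷ []))) ⟩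
    h 1 3 + h 3 2 + h 0 1 + h 2 0
      ≡⟨ solve 4 (λ x y z w → y :+ w :+ x :+ z := x :+ y :+ z :+ w) refl (h 0 1) (h 1 3) (h 2 0) (h 3 2) ⟩
    h 0 1 + h 1 3 + h 2 0 + h 3 2 ∎)
    where
    open ≡-Reasoning
    h : ℕ → ℕ → ℚ
    h p q = [ k ≡ᵇ label diag (a ℕ.+ p) (b ℕ.+ q) ]
    b+q≤n : ∀ q → q ≤ 4 → b ℕ.+ q ≤ n
    b+q≤n q q≤4 = ℕₚ.≤-trans (ℕₚ.+-monoʳ-≤ b q≤4) b+4≤n
    same : ∀ p q p' q' → {q≤4 : True (q ℕₚ.≤? 4)} {q'≤4 : True (q' ℕₚ.≤? 4)} →
      a ℕ.+ p ℕ.+ (b ℕ.+ q') ≡ a ℕ.+ p' ℕ.+ (b ℕ.+ q) → h p q ≡ h p' q'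
    same p q p' q' {q≤4} {q'≤4} eq = cong (λ m → [ k ≡ᵇ m ])
      (proj₂ (diag-label-≡⇔ (b+q≤n q (toWitness q≤4)) (b+q≤n q' (toWitness q'≤4))) eq)

  lineSumsVanish-X : ∀ a b → a ℕ.+ 4 ≤ n → b ℕ.+ 4 ≤ n → ∀ d k → lineSum d (X a b) k ≡ 0ℚ
  lineSumsVanish-X a b a+4≤n b+4≤n d k =
    trans (∑∑-X a b (λ i j → [ k ≡ᵇ label d i j ]) a+4≤n b+4≤n)
          (trans (cong (λ x → ∑X4⁺ h - x) (sym (X4-balanced d k a b b+4≤n))) (ℚₚ.+-inverseʳ (∑X4⁺ h)))
    where
    h : ℕ → ℕ → ℚ
    h p q = [ k ≡ᵇ label d (a ℕ.+ p) (b ℕ.+ q) ]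

  vanishes-by-line : ∀ y d i j → i < n → j < n → lineSum d y (label d i j) ≡ 0ℚ →
    (∀ i' j' → i' < n → j' < n → label d i j ≡ label d i' j' → (i' , j') ≢ (i , j) → y i' j' ≡ 0ℚ) →
    y i j ≡ 0ℚ
  vanishes-by-line y d i j i<n j<n line≡0 others≡0 = begin
    y i j                                          ≡⟨ sym (ℚₚ.*-identityˡ (y i j)) ⟩
    [ true ] * y i j                               ≡⟨ cong (λ b → [ b ] * y i j) (sym (≡ᵇ-refl (label d i j))) ⟩
    [ label d i j ≡ᵇ label d i j ] * y i j         ≡⟨ sym (∑∑-single n i j i<n j<n off-diagonal) ⟩
    lineSum d y (label d i j)                      ≡⟨ line≡0 ⟩
    0ℚ                                             ∎
    where
    open ≡-Reasoning
    off-diagonal : ∀ i' j' → i' < n → j' < n → (i' , j') ≢ (i , j) →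
      [ label d i j ≡ᵇ label d i' j' ] * y i' j' ≡ 0ℚ
    off-diagonal i' j' i'<n j'<n ≢ with label d i j ≡ᵇ label d i' j' | proof (label d i j ℕₚ.≟ label d i' j')
    ... | true  | ofʸ same = trans (cong ([ true ] *_) (others≡0 i' j' i'<n j'<n same ≢)) (ℚₚ.*-zeroʳ 1ℚ)
    ... | false | _        = ℚₚ.*-zeroˡ (y i' j')

module Uniqueness (N : ℕ) (y : ℕ → ℕ → ℚ)
  (vanish : Board.LineSumsVanish (3 ℕ.+ N) y)
  (pivots : ∀ a b → a < N → b < N → y a (suc b) ≡ 0ℚ) where
  open Board (3 ℕ.+ N)

  n : ℕ
  n = 3 ℕ.+ N

  N<n : N < n
  N<n = ℕₚ.m<n+m N (s≤s z≤n)

  1+N<n : 1 ℕ.+ N < n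
  1+N<n = s≤s (ℕₚ.m<n+m N (s≤s z≤n))

  2+N<n : 2 ℕ.+ N < n
  2+N<n = ℕₚ.n<1+n (2 ℕ.+ N)

  row-cases : ∀ {i} → i < 3 ℕ.+ N → i < N ⊎ i ≡ N ⊎ i ≡ 1 ℕ.+ N ⊎ i ≡ 2 ℕ.+ N
  row-cases {i} i<n with ℕₚ.<-cmp i N
  ... | tri< i<N _ _ = inj₁ i<N
  ... | tri≈ _ i≡N _ = inj₂ (inj₁ i≡N)
  ... | tri> _ _ N<i with ℕₚ.m≤n⇒m<n∨m≡n (ℕₚ.≤-pred i<n)
  ...   | inj₂ i≡2+N = inj₂ (inj₂ (inj₂ i≡2+N))
  ...   | inj₁ i<2+N with ℕₚ.m≤n⇒m<n∨m≡n (ℕₚ.≤-pred i<2+N)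
  ...     | inj₂ i≡1+N = inj₂ (inj₂ (inj₁ i≡1+N))
  ...     | inj₁ i<1+N = ⊥-elim (ℕₚ.<⇒≱ N<i (ℕₚ.≤-pred i<1+N))

  RowVanishes : ℕ → Set
  RowVanishes r = ∀ j → j < n → y r j ≡ 0ℚ

  -- In row r, (r , 0) is the only cell of its antidiagonal in rows ≥ r, and (r , 2 + N) the only
  -- one of its diagonal; with these and the pivots known, (r , 1 + N) is the last cell of the row.
  upper-row : ∀ r → r < N → (∀ {r'} → r' < r → RowVanishes r') → RowVanishes r
  upper-row r r<N above = row-r
    where
    r<n : r < n
    r<n = ℕₚ.<-trans r<N N<n
    first : y r 0 ≡ 0ℚ
    first = vanishes-by-line y antidiag r 0 r<n (s≤s z≤n) (vanish antidiag r 0 r<n (s≤s z≤n)) others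
      where
      others : ∀ i' j' → i' < n → j' < n → r ℕ.+ 0 ≡ i' ℕ.+ j' → (i' , j') ≢ (r , 0) → y i' j' ≡ 0ℚ
      others i' j' _ j'<n same ≢ with ℕₚ.m≤n⇒m<n∨m≡n i'≤r
        where
        i'≤r : i' ≤ r
        i'≤r = ℕₚ.≤-trans (ℕₚ.m≤m+n i' j') (ℕₚ.≤-reflexive (trans (sym same) (ℕₚ.+-identityʳ r)))
      ... | inj₁ i'<r = above i'<r j' j'<n
      ... | inj₂ refl = ⊥-elim (≢ (cong (i' ,_) (ℕₚ.+-cancelˡ-≡ i' j' 0 (sym same))))
    last : y r (2 ℕ.+ N) ≡ 0ℚ
    last = vanishes-by-line y diag r (2 ℕ.+ N) r<n 2+N<n (vanish diag r (2 ℕ.+ N) r<n 2+N<n) others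
      where
      others : ∀ i' j' → i' < n → j' < n → label diag r (2 ℕ.+ N) ≡ label diag i' j' →
        (i' , j') ≢ (r , 2 ℕ.+ N) → y i' j' ≡ 0ℚ
      others i' j' _ j'<n same ≢ = by-cases (ℕₚ.m≤n⇒m<n∨m≡n i'≤r)
        where
        r+j'≡i'+2+N : r ℕ.+ j' ≡ i' ℕ.+ (2 ℕ.+ N)
        r+j'≡i'+2+N = proj₁ (diag-label-≡⇔ (ℕₚ.n≤1+n (2 ℕ.+ N)) (ℕₚ.<⇒≤ j'<n)) same
        i'≤r : i' ≤ r
        i'≤r = ℕₚ.+-cancelʳ-≤ (2 ℕ.+ N) i' r
          (ℕₚ.≤-trans (ℕₚ.≤-reflexive (sym r+j'≡i'+2+N)) (ℕₚ.+-monoʳ-≤ r (ℕₚ.≤-pred j'<n)))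
        by-cases : i' < r ⊎ i' ≡ r → y i' j' ≡ 0ℚ
        by-cases (inj₁ i'<r) = above i'<r j' j'<n
        by-cases (inj₂ refl) = ⊥-elim (≢ (cong (i' ,_) (ℕₚ.+-cancelˡ-≡ i' j' (2 ℕ.+ N) r+j'≡i'+2+N)))
    off-middle : ∀ j → j < n → j ≢ 1 ℕ.+ N → y r j ≡ 0ℚ
    off-middle zero    _     _   = first
    off-middle (suc b) 1+b<n b≢N with ℕₚ.<-cmp b N
    ... | tri< b<N _ _ = pivots r b r<N b<N
    ... | tri≈ _ b≡N _ = ⊥-elim (b≢N (cong suc b≡N))
    ... | tri> _ _ N<b with ℕₚ.m≤n⇒m<n∨m≡n (ℕₚ.≤-pred (ℕₚ.≤-pred 1+b<n))
    ...   | inj₁ b<1+N = ⊥-elim (ℕₚ.<⇒≱ N<b (ℕₚ.≤-pred b<1+N))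
    ...   | inj₂ refl  = last
    middle : y r (1 ℕ.+ N) ≡ 0ℚ
    middle = vanishes-by-line y row r (1 ℕ.+ N) r<n 1+N<n (vanish row r (1 ℕ.+ N) r<n 1+N<n)
      λ { .r j' _ j'<n refl ≢ → off-middle j' j'<n (≢ ∘ cong (r ,_)) }
    row-r : RowVanishes r
    row-r j j<n with j ℕₚ.≟ 1 ℕ.+ N
    ... | yes refl = middle
    ... | no  j≢   = off-middle j j<n j≢

  upper-rows : ∀ r → r < N → RowVanishes r
  upper-rows = <-rec (λ r → r < N → RowVanishes r) λ r above r<N →
    upper-row r r<N (λ r'<r → above r'<r (ℕₚ.<-trans r'<r r<N))

  LowerVanishes : ℕ → Set
  LowerVanishes j = y N j ≡ 0ℚ × y (1 ℕ.+ N) j ≡ 0ℚ × y (2 ℕ.+ N) j ≡ 0ℚ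

  vanishes-by-rows : ∀ {i j} → i < n → (i < N → y i j ≡ 0ℚ) → LowerVanishes j → y i j ≡ 0ℚ
  vanishes-by-rows i<n upper lower with row-cases i<n
  ... | inj₁ i<N                = upper i<N
  ... | inj₂ (inj₁ refl)        = proj₁ lower
  ... | inj₂ (inj₂ (inj₁ refl)) = proj₁ (proj₂ lower)
  ... | inj₂ (inj₂ (inj₂ refl)) = proj₂ (proj₂ lower)

  -- Once the earlier columns are known, (2 + N , j) is alone on its diagonal and (N , j) alone on
  -- its antidiagonal; then (1 + N , j) is the last cell of column j.
  lower-column : ∀ j → j < n → (∀ {j'} → j' < j → LowerVanishes j') → LowerVanishes j
  lower-column j j<n left = top , centre , bottom
    where
    earlier : ∀ i j' → i < n → j' < j → y i j' ≡ 0ℚ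
    earlier i j' i<n j'<j =
      vanishes-by-rows i<n (λ i<N → upper-rows i i<N j' (ℕₚ.<-trans j'<j j<n)) (left j'<j)
    bottom : y (2 ℕ.+ N) j ≡ 0ℚ
    bottom = vanishes-by-line y diag (2 ℕ.+ N) j 2+N<n j<n (vanish diag (2 ℕ.+ N) j 2+N<n j<n) others
      where
      others : ∀ i' j' → i' < n → j' < n → label diag (2 ℕ.+ N) j ≡ label diag i' j' →
        (i' , j') ≢ (2 ℕ.+ N , j) → y i' j' ≡ 0ℚ
      others i' j' i'<n j'<n same ≢ = by-cases (ℕₚ.m≤n⇒m<n∨m≡n (ℕₚ.≤-pred i'<n))
        where
        2+N+j'≡i'+j : 2 ℕ.+ N ℕ.+ j' ≡ i' ℕ.+ j
        2+N+j'≡i'+j = proj₁ (diag-label-≡⇔ (ℕₚ.<⇒≤ j<n) (ℕₚ.<⇒≤ j'<n)) same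
        by-cases : i' < 2 ℕ.+ N ⊎ i' ≡ 2 ℕ.+ N → y i' j' ≡ 0ℚ
        by-cases (inj₁ i'<2+N) = earlier i' j' i'<n (+≡+⇒< i'<2+N 2+N+j'≡i'+j)
        by-cases (inj₂ refl)   = ⊥-elim (≢ (cong (i' ,_) (sym (ℕₚ.+-cancelˡ-≡ i' j j' (sym 2+N+j'≡i'+j)))))
    top : y N j ≡ 0ℚ
    top = vanishes-by-line y antidiag N j N<n j<n (vanish antidiag N j N<n j<n) others
      where
      others : ∀ i' j' → i' < n → j' < n → N ℕ.+ j ≡ i' ℕ.+ j' → (i' , j') ≢ (N , j) → y i' j' ≡ 0ℚ
      others i' j' i'<n j'<n same ≢ with ℕₚ.<-cmp i' N
      ... | tri< i'<N _ _ = upper-rows i' i'<N j' j'<n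
      ... | tri≈ _ refl _ = ⊥-elim (≢ (cong (N ,_) (sym (ℕₚ.+-cancelˡ-≡ N j j' same))))
      ... | tri> _ _ N<i' = earlier i' j' i'<n (+≡+⇒< N<i' (sym same))
    centre : y (1 ℕ.+ N) j ≡ 0ℚ
    centre = vanishes-by-line y col (1 ℕ.+ N) j 1+N<n j<n (vanish col (1 ℕ.+ N) j 1+N<n j<n) others
      where
      others : ∀ i' j' → i' < n → j' < n → j ≡ j' → (i' , j') ≢ (1 ℕ.+ N , j) → y i' j' ≡ 0ℚ
      others i' .j i'<n _ refl ≢ with row-cases i'<n
      ... | inj₁ i'<N                = upper-rows i' i'<N j j<n
      ... | inj₂ (inj₁ refl)        = top
      ... | inj₂ (inj₂ (inj₁ refl)) = ⊥-elim (≢ refl)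
      ... | inj₂ (inj₂ (inj₂ refl)) = bottom

  lower-rows : ∀ j → j < n → LowerVanishes j
  lower-rows = <-rec (λ j → j < n → LowerVanishes j) λ j left j<n →
    lower-column j j<n (λ j'<j → left j'<j (ℕₚ.<-trans j'<j j<n))

  vanishes : ∀ i j → i < n → j < n → y i j ≡ 0ℚ
  vanishes i j i<n j<n = vanishes-by-rows i<n (λ i<N → upper-rows i i<N j j<n) (lower-rows j j<n)

-- From Fin-indexed to ℕ-indexed vectors

sumFin≡∑ : ∀ n (g : Fin n → ℚ) (f : ℕ → ℚ) → (∀ k → g k ≡ f (toℕ k)) → sumFin n g ≡ ∑ n f
sumFin≡∑ zero    g f g≗f = refl
sumFin≡∑ (suc n) g f g≗f = cong₂ _+_ (g≗f Fin.zero) (sumFin≡∑ n (g ∘ Fin.suc) (f ∘ suc) (g≗f ∘ Fin.suc))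

does-≟-toℕ : ∀ {n} (i j : Fin n) → does (i Finₚ.≟ j) ≡ (toℕ i ≡ᵇ toℕ j)
does-≟-toℕ Fin.zero    Fin.zero    = refl
does-≟-toℕ Fin.zero    (Fin.suc j) = refl
does-≟-toℕ (Fin.suc i) Fin.zero    = refl
does-≟-toℕ (Fin.suc i) (Fin.suc j) = does-≟-toℕ i j

adjMat≡adjacentᵇ : ∀ {n} (i j i' j' : Fin n) →
  adjMat i j i' j' ≡ [ adjacentᵇ (toℕ i) (toℕ j) (toℕ i') (toℕ j') ]
adjMat≡adjacentᵇ i j i' j' rewrite does-≟-toℕ i i' | does-≟-toℕ j j' = refl

adjApply≡adjacency : ∀ n (v : Vect n) (y : ℕ → ℕ → ℚ) → (∀ i j → v i j ≡ y (toℕ i) (toℕ j)) →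
  ∀ i j → adjApply n v i j ≡ Board.adjacency n y (toℕ i) (toℕ j)
adjApply≡adjacency n v y v≗y i j =
  sumFin≡∑ n _ (λ i' → ∑ n λ j' → [ adjacentᵇ (toℕ i) (toℕ j) i' j' ] * y i' j') λ i' →
    sumFin≡∑ n _ (λ j' → [ adjacentᵇ (toℕ i) (toℕ j) (toℕ i') j' ] * y (toℕ i') j') λ j' →
      cong₂ _*_ (adjMat≡adjacentᵇ i j i' j') (v≗y i' j')

extend : ∀ {n} → (Fin n → Fin n → ℚ) → ℕ → ℕ → ℚ
extend {n} v i j with i ℕₚ.<? n | j ℕₚ.<? n
... | yes i<n | yes j<n = v (fromℕ< i<n) (fromℕ< j<n)
... | _       | _       = 0ℚ

extend-toℕ : ∀ {n} (v : Fin n → Fin n → ℚ) i j → extend v (toℕ i) (toℕ j) ≡ v i j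
extend-toℕ {n} v i j with toℕ i ℕₚ.<? n | toℕ j ℕₚ.<? n
... | yes i<n | yes j<n = cong₂ v (Finₚ.fromℕ<-toℕ i i<n) (Finₚ.fromℕ<-toℕ j j<n)
... | no  i≮n | _       = ⊥-elim (i≮n (Finₚ.toℕ<n i))
... | yes _   | no  j≮n = ⊥-elim (j≮n (Finₚ.toℕ<n j))

∀-toℕ⇒∀< : ∀ {n} (P : ℕ → ℕ → Set) → (∀ (i j : Fin n) → P (toℕ i) (toℕ j)) → ∀ i j → i < n → j < n → P i j
∀-toℕ⇒∀< P P-toℕ i j i<n j<n =
  subst₂ P (Finₚ.toℕ-fromℕ< i<n) (Finₚ.toℕ-fromℕ< j<n) (P-toℕ (fromℕ< i<n) (fromℕ< j<n))

-- The eigenspace E(-4)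

module Eigenspace (N : ℕ) where
  open Board (3 ℕ.+ N)

  n : ℕ
  n = 3 ℕ.+ N

  combination : (ℕ → ℕ → ℚ) → ℕ → ℕ → ℚ
  combination C i j = ∑∑ N λ a b → C a b * X a b i j

  open UnitriangularSystem N (λ a' b' a b → X a' b' a (suc b)) X-pivot X-beyond-pivot

  a+4≤n : ∀ {a} → a < N → a ℕ.+ 4 ≤ n
  a+4≤n {a} a<N = subst₂ _≤_ (sym (ℕₚ.+-suc a 3)) (ℕₚ.+-comm N 3) (ℕₚ.+-monoˡ-≤ 3 a<N)

  lineSumsVanish-combination : ∀ C d k → lineSum d (combination C) k ≡ 0ℚ
  lineSumsVanish-combination C d k = begin
    ∑∑ n (λ i j → [ k ≡ᵇ label d i j ] * ∑∑ N λ a b → C a b * X a b i j)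
      ≡⟨ ∑∑-cong n (λ i j _ _ → trans (*-distribˡ-∑∑ N [ k ≡ᵇ label d i j ] λ a b → C a b * X a b i j)
                                      (∑∑-cong N λ a b _ _ → rearrange i j a b)) ⟩
    ∑∑ n (λ i j → ∑∑ N λ a b → C a b * ([ k ≡ᵇ label d i j ] * X a b i j))
      ≡⟨ ∑∑-comm n N (λ i j a b → C a b * ([ k ≡ᵇ label d i j ] * X a b i j)) ⟩
    ∑∑ N (λ a b → ∑∑ n λ i j → C a b * ([ k ≡ᵇ label d i j ] * X a b i j))
      ≡⟨ ∑∑-cong N (λ a b a<N b<N → term≡0 a b a<N b<N) ⟩
    ∑∑ N (λ _ _ → 0ℚ)
      ≡⟨ ∑∑-zero N (λ _ _ _ _ → refl) ⟩
    0ℚ ∎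
    where
    open ≡-Reasoning
    rearrange : ∀ i j a b →
      [ k ≡ᵇ label d i j ] * (C a b * X a b i j) ≡ C a b * ([ k ≡ᵇ label d i j ] * X a b i j)
    rearrange i j a b =
      solve 3 (λ g c x → g :* (c :* x) := c :* (g :* x)) refl [ k ≡ᵇ label d i j ] (C a b) (X a b i j)
    term≡0 : ∀ a b → a < N → b < N → ∑∑ n (λ i j → C a b * ([ k ≡ᵇ label d i j ] * X a b i j)) ≡ 0ℚ
    term≡0 a b a<N b<N = begin
      ∑∑ n (λ i j → C a b * ([ k ≡ᵇ label d i j ] * X a b i j))
        ≡⟨ sym (*-distribˡ-∑∑ n (C a b) λ i j → [ k ≡ᵇ label d i j ] * X a b i j) ⟩
      C a b * lineSum d (X a b) k
        ≡⟨ cong (C a b *_) (lineSumsVanish-X a b (a+4≤n a<N) (a+4≤n b<N) d k) ⟩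
      C a b * 0ℚ
        ≡⟨ ℚₚ.*-zeroʳ (C a b) ⟩
      0ℚ ∎

  pivot-in-board : ∀ {a b} → a < N → b < N → a < n × suc b < n
  pivot-in-board a<N b<N =
    ℕₚ.<-≤-trans a<N (ℕₚ.m≤n+m N 3) , ℕₚ.<-≤-trans (s≤s b<N) (ℕₚ.m≤n+m (suc N) 2)

  eigenvector-X : ∀ a b → a < N → b < N → Eigenvector-4 (X a b)
  eigenvector-X a b a<N b<N = lineSumsVanish⇒eigenvector (X a b) λ d i j _ _ →
    lineSumsVanish-X a b (a+4≤n a<N) (a+4≤n b<N) d (label d i j)

  independent : ∀ C → (∀ i j → i < n → j < n → combination C i j ≡ 0ℚ) →
    ∀ a b → a < N → b < N → C a b ≡ 0ℚ
  independent C combination≡0 = apply-injective C λ a b a<N b<N →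
    combination≡0 a (suc b) (proj₁ (pivot-in-board a<N b<N)) (proj₂ (pivot-in-board a<N b<N))

  spanning : ∀ y → Eigenvector-4 y →
    Σ[ C ∈ (ℕ → ℕ → ℚ) ] (∀ i j → i < n → j < n → y i j ≡ combination C i j)
  spanning y eigen = C , λ i j i<n j<n →
    x∙y⁻¹≈ε⇒x≈y (y i j) (combination C i j)
      (Uniqueness.vanishes N residual residual-lineSums residual-pivots i j i<n j<n)
    where
    C : ℕ → ℕ → ℚ
    C = proj₁ (apply-surjective λ a b → y a (suc b))
    C-on-pivots : ∀ a b → a < N → b < N → combination C a (suc b) ≡ y a (suc b)
    C-on-pivots = proj₂ (apply-surjective λ a b → y a (suc b))
    residual : ℕ → ℕ → ℚ
    residual i j = y i j - combination C i j
    residual-lineSums : LineSumsVanish residual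
    residual-lineSums d i j i<n j<n =
      trans (lineSum-distrib-- d y (combination C) (label d i j))
            (cong₂ _-_ (eigenvector⇒lineSumsVanish y eigen d i j i<n j<n)
                       (lineSumsVanish-combination C d (label d i j)))
    residual-pivots : ∀ a b → a < N → b < N → residual a (suc b) ≡ 0ℚ
    residual-pivots a b a<N b<N =
      trans (cong (λ x → y a (suc b) - x) (C-on-pivots a b a<N b<N)) (ℚₚ.+-inverseʳ (y a (suc b)))

  inEigenspace-Xn : ∀ a b → InEigenspace n minus4 (Xn n a b)
  inEigenspace-Xn a b i j =
    trans (adjApply≡adjacency n (Xn n a b) (X (toℕ a) (toℕ b)) (λ _ _ → refl) i j)
          (eigenvector-X (toℕ a) (toℕ b) (Finₚ.toℕ<n a) (Finₚ.toℕ<n b)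
                         (toℕ i) (toℕ j) (Finₚ.toℕ<n i) (Finₚ.toℕ<n j))

  combo≡combination : ∀ c C → (∀ a b → c a b ≡ C (toℕ a) (toℕ b)) →
    ∀ i j → combo n c i j ≡ combination C (toℕ i) (toℕ j)
  combo≡combination c C c≗C i j =
    sumFin≡∑ N _ (λ a → ∑ N λ b → C a b * X a b (toℕ i) (toℕ j)) λ a →
      sumFin≡∑ N _ (λ b → C (toℕ a) b * X (toℕ a) b (toℕ i) (toℕ j)) λ b →
        cong (_* X (toℕ a) (toℕ b) (toℕ i) (toℕ j)) (c≗C a b)

  Xn-independent : ∀ c → (∀ i j → combo n c i j ≡ 0ℚ) → ∀ a b → c a b ≡ 0ℚ
  Xn-independent c combo≡0 a b = trans (sym (extend-toℕ c a b))
    (independent (extend c) combination≡0 (toℕ a) (toℕ b) (Finₚ.toℕ<n a) (Finₚ.toℕ<n b))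
    where
    combination≡0 : ∀ i j → i < n → j < n → combination (extend c) i j ≡ 0ℚ
    combination≡0 = ∀-toℕ⇒∀< (λ i j → combination (extend c) i j ≡ 0ℚ) λ i j →
      trans (sym (combo≡combination c (extend c) (λ a b → sym (extend-toℕ c a b)) i j)) (combo≡0 i j)

  Xn-spanning : ∀ v → InEigenspace n minus4 v →
    Σ[ c ∈ (Fin N → Fin N → ℚ) ] (∀ i j → v i j ≡ combo n c i j)
  Xn-spanning v v∈E = (λ a b → C (toℕ a) (toℕ b)) , λ i j → begin
    v i j                                   ≡⟨ sym (extend-toℕ v i j) ⟩
    extend v (toℕ i) (toℕ j)                ≡⟨ v≡combination (toℕ i) (toℕ j) (Finₚ.toℕ<n i) (Finₚ.toℕ<n j) ⟩
    combination C (toℕ i) (toℕ j)           ≡⟨ sym (combo≡combination (λ a b → C (toℕ a) (toℕ b)) C (λ _ _ → refl) i j) ⟩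
    combo n (λ a b → C (toℕ a) (toℕ b)) i j ∎
    where
    open ≡-Reasoning
    eigenvector : Eigenvector-4 (extend v)
    eigenvector = ∀-toℕ⇒∀< (λ i j → adjacency (extend v) i j ≡ minus4 * extend v i j) λ i j →
      trans (sym (adjApply≡adjacency n v (extend v) (λ i j → sym (extend-toℕ v i j)) i j))
            (trans (v∈E i j) (cong (minus4 *_) (sym (extend-toℕ v i j))))
    C : ℕ → ℕ → ℚ
    C = proj₁ (spanning (extend v) eigenvector)
    v≡combination : ∀ i j → i < n → j < n → extend v i j ≡ combination C i j
    v≡combination = proj₂ (spanning (extend v) eigenvector)

theorem4p3 : ∀ (n : ℕ) → 4 ≤ n →
    IsEigenvalue n minus4 × IsBasisOfEigenspace n minus4
theorem4p3 .(3 ℕ.+ suc N) (s≤s (s≤s (s≤s (s≤s (z≤n {N}))))) =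
  (Xn (3 ℕ.+ suc N) Fin.zero Fin.zero , inEigenspace-Xn Fin.zero Fin.zero ,
   Fin.zero , Fin.suc Fin.zero , λ ()) ,
  inEigenspace-Xn , Xn-independent , Xn-spanning
  where open Eigenspace (suc N)
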